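{- Let $G$ be a connected graph equipped with nonnegative real edge weights ${\bf w}=\{w_e\}_{e\in E(G)}$, and let $T$ (with edge weights ${\bf w}^T$) be a Gomory--Hu tree for $(G,{\bf w})$. Then $$\Lambda(G,{\bf w})=\widehat{\Lambda}(G,{\bf w};T)=\widetilde{\Lambda}(G,{\bf w})\le \Delta_2(G,{\bf w})\le\Delta(G,{\bf w}).$$ In particular, the value of $\widehat{\Lambda}(G,{\bf w};T)$ is independent of the choice of the Gomory--Hu tree $T$.
   Context: Graphs are finite, undirected and loopless; multiple edges are allowed. The weighted degree of $x\in V(G)$ is $d_G(x,{\bf w})=\sum_{e\ni x}w_e$; $\Delta(G,{\bf w})=\max_{x}d_G(x,{\bf w})$ and $\Delta_2(G,{\bf w})=\min_{x_1\in V(G)}\max_{x\in V(G)\setminus\{x_1\}}d_G(x,{\bf w})$. For disjoint $X,Y\subseteq V(G)$, $E(X,Y)$ is the set of edges between $X$ and $Y$. For distinct $x,y$, $\lambda_G(x,y;{\bf w})$ is the maximum flow from $x$ to $y$ with edge capacities $w_e$, equivalently the minimum of $\sum_{e\in E(X,V(G)\setminus X)}w_e$ over $X\subseteq V(G)$ with $x\in X$, $y\notin X$; the maxmaxflow is $\Lambda(G,{\bf w})=\max_{x\neq y}\lambda_G(x,y;{\bf w})$. A cocycle is a set $E(X,V(G)\setminus X)$, $X\subseteq V(G)$; cocycles form a GF(2)-vector space under symmetric difference (the cocycle space), and $\widetilde{\Lambda}(G,{\bf w})=\min_{\mathcal B}\max_{C\in\mathcal B}\sum_{e\in C}w_e$,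 the minimum over all bases $\mathcal B$ of the cocycle space. For a tree $T$ on vertex set $V(G)$ and $e\in E(T)$, the elementary cocycle of $G$ corresponding to $e$ and $T$ is $E_G(X,Y)$ where $X,Y$ are the vertex sets of the two components of $T-e$. A Gomory--Hu tree for $(G,{\bf w})$ is a tree $T$ with $V(T)=V(G)$ (not necessarily a subgraph of $G$) with nonnegative edge weights ${\bf w}^T$ such that (a) $\lambda_G(x,y;{\bf w})=\lambda_T(x,y;{\bf w}^T)$ for all distinct $x,y$, and (b) for each $e=xy\in E(T)$, the elementary cocycle $C$ of $G$ corresponding to $e$ and $T$ satisfies $\sum_{f\in C}w_f=\lambda_G(x,y;{\bf w})$. Such trees exist. Define $\widehat{\Lambda}(G,{\bf w};T)=\max_{e\in E(T)}w^T_e$. -}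

module Defs where

open import Level using (Level; _⊔_) renaming (suc to lsuc)
open import Data.Nat using (ℕ; zero; suc)
open import Data.Fin using (Fin; zero; suc)
open import Data.Bool using (Bool; true; false; if_then_else_; _xor_)
open import Data.List using (List; []; _∷_)
open import Data.List.Relation.Unary.Unique.Propositional using (Unique)
open import Data.Product using (Σ; Σ-syntax; ∃; ∃-syntax; _×_; _,_)
open import Relation.Binary.PropositionalEquality using (_≡_; _≢_)
open import Relation.Binary using (Rel; IsTotalOrder)
open import Algebra.Structures using (IsCommutativeMonoid)
open import Relation.Nullary using (¬_)

-- The paper uses nonnegative reals.  We work over an
-- arbitrary totally ordered commutative monoid whose addition is
-- monotone; the reals (with equality, ≤, +, 0) are an instance, so the
-- theorem for every such structure contains the paper's statement.

record WeightDomain (c ℓ₁ ℓ₂ : Level) : Set (lsuc (c ⊔ ℓ₁ ⊔ ℓ₂)) where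
  field
    Carrier : Set c
    _≈_     : Rel Carrier ℓ₁
    _≤_     : Rel Carrier ℓ₂
    _+_     : Carrier → Carrier → Carrier
    0#      : Carrier
    isCommutativeMonoid : IsCommutativeMonoid _≈_ _+_ 0#
    isTotalOrder        : IsTotalOrder _≈_ _≤_
    +-monoˡ-≤ : ∀ {x y} z → x ≤ y → x + z ≤ y + z
  infix 4 _≈_ _≤_
  infixl 6 _+_

record Graph (n m : ℕ) : Set where
  field
    src tgt  : Fin m → Fin n
    loopless : ∀ e → src e ≢ tgt e

module _ {n m : ℕ} (G : Graph n m) where
  open Graph G

  data Walk : Fin n → Fin n → List (Fin m) → Set where
    nil  : ∀ {u} → Walk u u []
    fwd  : ∀ {u v es} e → src e ≡ u → Walk (tgt e) v es → Walk u v (e ∷ es)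
    bwd  : ∀ {u v es} e → tgt e ≡ u → Walk (src e) v es → Walk u v (e ∷ es)

  Connected : Set
  Connected = ∀ u v → ∃[ es ] Walk u v es

  Acyclic : Set
  Acyclic = ∀ u es → Walk u u es → Unique es → es ≡ []

  IsTree : Set
  IsTree = Connected × Acyclic

  VSet : Set
  VSet = Fin n → Bool

  ESet : Set
  ESet = Fin m → Bool

  cocycleOf : VSet → ESet
  cocycleOf X e = X (src e) xor X (tgt e)

  IsCocycle : ESet → Set
  IsCocycle C = ∃[ X ] (∀ e → C e ≡ cocycleOf X e)

  -- the vertex set of the component of T − f containing src f
  -- (here G plays the role of T)
  IsSideOf : Fin m → VSet → Set
  IsSideOf f X = ∀ z → (X z ≡ true → ∃[ es ] (Walk (src f) z es × ¬ (Data.List.Membership.Propositional._∈_ f es)))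
                     × (∀ es → Walk (src f) z es → ¬ (Data.List.Membership.Propositional._∈_ f es) → X z ≡ true)
    where import Data.List.Membership.Propositional

module _ {c ℓ₁ ℓ₂} (D : WeightDomain c ℓ₁ ℓ₂) where
  open WeightDomain D

  ∑ : (k : ℕ) → (Fin k → Carrier) → Carrier
  ∑ zero    f = 0#
  ∑ (suc k) f = f zero + ∑ k (λ i → f (suc i))

  module _ {n m : ℕ} (G : Graph n m) (w : Fin m → Carrier) where
    open Graph G

    Nonneg : Set _
    Nonneg = ∀ e → 0# ≤ w e

    weight : ESet G → Carrier
    weight C = ∑ m (λ e → if C e then w e else 0#)

    deg : Fin n → Carrier
    deg x = ∑ m (λ e → if (src e Data.Fin.≟ x) .Relation.Nullary.does then w e else
                        (if (tgt e Data.Fin.≟ x) .Relation.Nullary.does then w e else 0#))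
      where import Data.Fin; import Relation.Nullary

    IsΔ : Carrier → Set _
    IsΔ v = (∃[ x ] deg x ≈ v) × (∀ x → deg x ≤ v)

    IsMaxDegWithout : Fin n → Carrier → Set _
    IsMaxDegWithout x₁ v = (∃[ x ] (x ≢ x₁ × deg x ≈ v)) × (∀ x → x ≢ x₁ → deg x ≤ v)

    IsΔ₂ : Carrier → Set _
    IsΔ₂ v = (∃[ x₁ ] IsMaxDegWithout x₁ v)
           × (∀ x₁ u → IsMaxDegWithout x₁ u → v ≤ u)

    Separates : VSet G → Fin n → Fin n → Set
    Separates X x y = X x ≡ true × X y ≡ false

    -- v = λ_G(x, y; w), the minimum cut value (equal to max flow)
    IsLocalCon : Fin n → Fin n → Carrier → Set _
    IsLocalCon x y v = (∃[ X ] (Separates X x y × weight (cocycleOf G X) ≈ v))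
                     × (∀ X → Separates X x y → v ≤ weight (cocycleOf G X))

    IsΛ : Carrier → Set _
    IsΛ v = (∃[ x ] ∃[ y ] (x ≢ y × IsLocalCon x y v))
          × (∀ x y u → x ≢ y → IsLocalCon x y u → u ≤ v)

    combo : ∀ {k} → (Fin k → ESet G) → (Fin k → Bool) → ESet G
    combo {zero}  B S e = false
    combo {suc k} B S e =
      (if S zero then B zero e else false) xor combo (λ i → B (suc i)) (λ i → S (suc i)) e

    IsCocycleBasis : ∀ {k} → (Fin k → ESet G) → Set
    IsCocycleBasis {k} B =
        (∀ i → IsCocycle G (B i))
      × (∀ S → (∀ e → combo B S e ≡ false) → ∀ i → S i ≡ false)
      × (∀ C → IsCocycle G C → ∃[ S ] (∀ e → C e ≡ combo B S e))

    IsMaxWeightIn : ∀ {k} → (Fin k → ESet G) → Carrier → Set _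
    IsMaxWeightIn {k} B v = (∃[ i ] weight (B i) ≈ v) × (∀ i → weight (B i) ≤ v)

    IsΛ̃ : Carrier → Set _
    IsΛ̃ v = (∃[ k ] ∃[ B ] (IsCocycleBasis {k} B × IsMaxWeightIn B v))
          × (∀ k (B : Fin k → ESet G) u → IsCocycleBasis B → IsMaxWeightIn B u → v ≤ u)

  IsGomoryHuTree : ∀ {n m k} (G : Graph n m) (w : Fin m → Carrier)
                   (T : Graph n k) (wT : Fin k → Carrier) → Set _
  IsGomoryHuTree G w T wT =
      IsTree T
    × Nonneg T wT
    × (∀ x y → x ≢ y → ∀ u v → IsLocalCon G w x y u → IsLocalCon T wT x y v → u ≈ v)
    × (∀ f X → IsSideOf T f X → IsLocalCon G w (Graph.src T f) (Graph.tgt T f) (weight G w (cocycleOf G X)))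

  IsΛ̂ : ∀ {n k} (T : Graph n k) (wT : Fin k → Carrier) → Carrier → Set _
  IsΛ̂ {k = k} T wT v = (∃[ e ] wT e ≈ v) × (∀ e → wT e ≤ v)

-- For an edge f of the tree T let side f be the component of T − f containing src f.
-- A GF(2)-combination of sides, ⊕_{f ∈ S} side f, is crossed by exactly the tree edges in S;
-- since G and T are connected, the elementary cocycles δ(side f) therefore form a basis of
-- the cocycle space of G, and any two distinct vertices are separated by some side f.
-- Gomory–Hu property (b) makes δ(side f) a minimum (src f, tgt f)-cut of G, and property (a)
-- gives it weight wT f.  Let h be the heaviest tree edge.  Every λ(x, y) is at most the weight
-- of an elementary cocycle separating x from y, so Λ = wT h.  The elementary basis has maximum
-- weight wT h, while every basis spans the cut of {x}, so one of its members separates x from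
-- y and weighs at least λ(x, y); taking x, y the ends of h gives Λ̃ = Λ.  Finally λ(x, y) is
-- at most the degree of whichever of x, y is not the vertex excluded in Δ₂, and Δ₂ ≤ Δ.

module Submission where

open import Defs
open import Level using (Level)
open import Data.Nat using (ℕ) renaming (_≤_ to _≤ℕ_)
open import Data.Fin using (Fin)
open import Data.Product using (Σ-syntax; ∃-syntax; _×_)

open import Function using (_∘_)
open import Data.Nat using (zero; suc; s≤s; z≤n)
open import Data.Fin using (zero; suc; _≟_; punchIn; punchOut)
open import Data.Fin.Properties using (suc-injective; punchInᵢ≢i; punchIn-punchOut)
open import Data.Bool using (Bool; true; false; not; _∧_; _xor_; if_then_else_)
open import Data.Bool.Properties
  using (xor-same; xor-identityʳ; xor-annihilates-not; ∧-distribˡ-xor; ∧-identityʳ; ∧-zeroʳ)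
open import Data.Bool.Solver using (module xor-∧-Solver)
open xor-∧-Solver using (solve; _:+_; _:=_)
open import Data.List using (List; []; _∷_; _++_; allFin)
open import Data.List.Membership.Propositional using (_∈_; _∉_)
open import Data.List.Membership.Propositional.Properties using (∈-++⁺ʳ; ∈-allFin)
open import Data.List.Membership.DecPropositional using () renaming (_∈?_ to ∈?[_])
open import Data.List.Relation.Binary.Subset.Propositional using (_⊆_)
open import Data.List.Relation.Unary.Any using (here; there)
open import Data.List.Relation.Unary.All using (lookup)
open import Data.List.Relation.Unary.All.Properties using (All¬⇒¬Any; ¬Any⇒All¬)
open import Data.List.Relation.Unary.AllPairs using ([]; _∷_)
open import Data.List.Relation.Unary.Unique.Propositional using (Unique)
open import Data.Product using (_,_; proj₁; proj₂)
open import Data.Empty using (⊥-elim)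
open import Relation.Nullary using (¬_; yes; no; does)
open import Relation.Nullary.Decidable using (dec-true; dec-false)
open import Relation.Binary.PropositionalEquality
  using (_≡_; _≢_; refl; sym; trans; cong; cong₂; subst; ≢-sym; module ≡-Reasoning)
open import Relation.Binary using (IsTotalOrder)
open import Relation.Binary.Bundles using (TotalOrder)
import Relation.Binary.Reasoning.PartialOrder as PartialOrderReasoning
import Data.List.Extrema as Extrema
open import Algebra.Structures using (IsCommutativeMonoid)

xor-telescope : ∀ a b c → a xor c ≡ (a xor b) xor (b xor c)
xor-telescope = solve 3 (λ a b c → a :+ c := (a :+ b) :+ (b :+ c)) refl

xor-telescope′ : ∀ a b c → a xor c ≡ (b xor a) xor (b xor c)
xor-telescope′ = solve 3 (λ a b c → a :+ c := (b :+ a) :+ (b :+ c)) refl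

xor-interchange : ∀ a b c d → (a xor b) xor (c xor d) ≡ (a xor c) xor (b xor d)
xor-interchange = solve 4 (λ a b c d → (a :+ b) :+ (c :+ d) := (a :+ c) :+ (b :+ d)) refl

≢⇒xor≡true : ∀ {a b} → a ≢ b → a xor b ≡ true
≢⇒xor≡true {true}  {false} _ = refl
≢⇒xor≡true {false} {true}  _ = refl
≢⇒xor≡true {true}  {true}  a≢b = ⊥-elim (a≢b refl)
≢⇒xor≡true {false} {false} a≢b = ⊥-elim (a≢b refl)

xor≡true⇒≢ : ∀ {a b} → a xor b ≡ true → a ≢ b
xor≡true⇒≢ {true}  () refl
xor≡true⇒≢ {false} () refl

≡true⇔⇒≡ : ∀ {a b} → (a ≡ true → b ≡ true) → (b ≡ true → a ≡ true) → a ≡ b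
≡true⇔⇒≡ {true}  a⇒b _   = sym (a⇒b refl)
≡true⇔⇒≡ {false} {true}  _ b⇒a = b⇒a refl
≡true⇔⇒≡ {false} {false} _ _   = refl

Unique-++⁻ʳ : ∀ {A : Set} (xs : List A) {ys} → Unique (xs ++ ys) → Unique ys
Unique-++⁻ʳ []       xs++ys! = xs++ys!
Unique-++⁻ʳ (x ∷ xs) (_ ∷ xs++ys!) = Unique-++⁻ʳ xs xs++ys!

∉-prefix : ∀ {A : Set} (xs : List A) {y ys} → Unique (xs ++ y ∷ ys) → y ∉ xs
∉-prefix (x ∷ xs) (x∉ ∷ _) (here refl) = All¬⇒¬Any x∉ (∈-++⁺ʳ xs (here refl))
∉-prefix (x ∷ xs) (_ ∷ xs++ys!) (there y∈xs) = ∉-prefix xs xs++ys! y∈xs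

∉-suffix : ∀ {A : Set} (xs : List A) {y ys} → Unique (xs ++ y ∷ ys) → y ∉ ys
∉-suffix xs xs++ys! with Unique-++⁻ʳ xs xs++ys!
... | y∉ ∷ _ = All¬⇒¬Any y∉

parity : ∀ {k} → (Fin k → Bool) → Bool
parity {zero}  b = false
parity {suc k} b = b zero xor parity (b ∘ suc)

lincomb : ∀ {k} {A : Set} → (Fin k → Bool) → (Fin k → A → Bool) → A → Bool
lincomb S Y a = parity (λ i → S i ∧ Y i a)

parity-cong : ∀ {k} {b c : Fin k → Bool} → (∀ i → b i ≡ c i) → parity b ≡ parity c
parity-cong {zero}  _   = refl
parity-cong {suc k} b≗c = cong₂ _xor_ (b≗c zero) (parity-cong (b≗c ∘ suc))

parity-xor : ∀ {k} (b c : Fin k → Bool) → parity b xor parity c ≡ parity (λ i → b i xor c i)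
parity-xor {zero}  b c = refl
parity-xor {suc k} b c =
  trans (xor-interchange (b zero) (parity (b ∘ suc)) (c zero) (parity (c ∘ suc)))
        (cong ((b zero xor c zero) xor_) (parity-xor (b ∘ suc) (c ∘ suc)))

parity-false : ∀ {k} (b : Fin k → Bool) → (∀ i → b i ≡ false) → parity b ≡ false
parity-false {zero}  b _      = refl
parity-false {suc k} b b≡false = cong₂ _xor_ (b≡false zero) (parity-false (b ∘ suc) (b≡false ∘ suc))

parity-single : ∀ {k} (b : Fin k → Bool) j → (∀ i → i ≢ j → b i ≡ false) → parity b ≡ b j
parity-single {suc k} b zero others =
  trans (cong (b zero xor_) (parity-false (b ∘ suc) (λ i → others (suc i) (λ ()))))
        (xor-identityʳ (b zero))
parity-single {suc k} b (suc j) others =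
  trans (cong (_xor parity (b ∘ suc)) (others zero (λ ())))
        (parity-single (b ∘ suc) j (λ i i≢j → others (suc i) (i≢j ∘ suc-injective)))

parity-true : ∀ {k} (b : Fin k → Bool) → parity b ≡ true → ∃[ i ] b i ≡ true
parity-true {suc k} b odd with b zero in b₀
... | true  = zero , b₀
... | false = let i , bᵢ = parity-true (b ∘ suc) odd in suc i , bᵢ

lincomb-separates : ∀ {k} {A : Set} (S : Fin k → Bool) (Y : Fin k → A → Bool) {a a′} →
                    lincomb S Y a ≢ lincomb S Y a′ → ∃[ i ] Y i a ≢ Y i a′
lincomb-separates S Y {a} {a′} differ =
  let i , odd = parity-true _ (trans (sym (parity-xor (λ i → S i ∧ Y i a) (λ i → S i ∧ Y i a′)))
                                     (≢⇒xor≡true differ))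
  in  i , λ same → xor≡true⇒≢ odd (cong (S i ∧_) same)

singleton : ∀ {n} → Fin n → Fin n → Bool
singleton x z = does (z ≟ x)

singleton-separates : ∀ {n} {x y : Fin n} → x ≢ y → singleton x x ≢ singleton x y
singleton-separates {x = x} {y} x≢y same
  with trans (sym (dec-true (x ≟ x) refl)) (trans same (dec-false (y ≟ x) (≢-sym x≢y)))
... | ()

module Walks {n m : ℕ} (H : Graph n m) where
  open Graph H

  crossings : ESet H → List (Fin m) → Bool
  crossings C []       = false
  crossings C (e ∷ es) = C e xor crossings C es

  crossings-cong : ∀ {C C′ : ESet H} → (∀ e → C e ≡ C′ e) → ∀ es → crossings C es ≡ crossings C′ es
  crossings-cong C≗C′ []       = refl
  crossings-cong C≗C′ (e ∷ es) = cong₂ _xor_ (C≗C′ e) (crossings-cong C≗C′ es)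

  walk-crossings : ∀ (X : VSet H) {u v es} → Walk H u v es → X u xor X v ≡ crossings (cocycleOf H X) es
  walk-crossings X {u} nil = xor-same (X u)
  walk-crossings X {v = v} (fwd e refl r) =
    trans (xor-telescope (X (src e)) (X (tgt e)) (X v)) (cong (cocycleOf H X e xor_) (walk-crossings X r))
  walk-crossings X {v = v} (bwd e refl r) =
    trans (xor-telescope′ (X (tgt e)) (X (src e)) (X v)) (cong (cocycleOf H X e xor_) (walk-crossings X r))

  sameCocycle⇒sameSeparation : Connected H → ∀ (X Y : VSet H) →
    (∀ e → cocycleOf H X e ≡ cocycleOf H Y e) → ∀ x y → X x xor X y ≡ Y x xor Y y
  sameCocycle⇒sameSeparation connected X Y same x y = begin
    X x xor X y                  ≡⟨ walk-crossings X walk ⟩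
    crossings (cocycleOf H X) es ≡⟨ crossings-cong same es ⟩
    crossings (cocycleOf H Y) es ≡⟨ walk-crossings Y walk ⟨
    Y x xor Y y                  ∎
    where
    open ≡-Reasoning
    es   = proj₁ (connected x y)
    walk = proj₂ (connected x y)

  cocycleOf-lincomb : ∀ {k} (S : Fin k → Bool) (Y : Fin k → VSet H) e →
                      cocycleOf H (lincomb S Y) e ≡ lincomb S (λ i → cocycleOf H (Y i)) e
  cocycleOf-lincomb S Y e =
    trans (parity-xor (λ i → S i ∧ Y i (src e)) (λ i → S i ∧ Y i (tgt e)))
          (parity-cong (λ i → sym (∧-distribˡ-xor (S i) (Y i (src e)) (Y i (tgt e)))))

  data Split (f : Fin m) (u v : Fin n) (es : List (Fin m)) : Set where
    forward  : ∀ es₁ es₂ → es ≡ es₁ ++ f ∷ es₂ →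
               Walk H u (src f) es₁ → Walk H (tgt f) v es₂ → Split f u v es
    backward : ∀ es₁ es₂ → es ≡ es₁ ++ f ∷ es₂ →
               Walk H u (tgt f) es₁ → Walk H (src f) v es₂ → Split f u v es

  split : ∀ {f u v es} → Walk H u v es → f ∈ es → Split f u v es
  split (fwd e refl r) (here refl) = forward  [] _ refl nil r
  split (bwd e refl r) (here refl) = backward [] _ refl nil r
  split (fwd e refl r) (there f∈es) with split r f∈es
  ... | forward  es₁ es₂ refl t₁ t₂ = forward  (e ∷ es₁) es₂ refl (fwd e refl t₁) t₂
  ... | backward es₁ es₂ refl t₁ t₂ = backward (e ∷ es₁) es₂ refl (fwd e refl t₁) t₂
  split (bwd e refl r) (there f∈es) with split r f∈es
  ... | forward  es₁ es₂ refl t₁ t₂ = forward  (e ∷ es₁) es₂ refl (bwd e refl t₁) t₂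
  ... | backward es₁ es₂ refl t₁ t₂ = backward (e ∷ es₁) es₂ refl (bwd e refl t₁) t₂

  toTrail : ∀ {u v es} → Walk H u v es → ∃[ es′ ] (Walk H u v es′ × Unique es′ × es′ ⊆ es)
  toTrail nil = [] , nil , [] , λ ()
  toTrail (fwd e refl r) with toTrail r
  ... | es′ , t , t! , es′⊆ with ∈?[ _≟_ ] e es′
  ...   | no e∉ = e ∷ es′ , fwd e refl t , ¬Any⇒All¬ es′ e∉ ∷ t! ,
                  λ { (here refl) → here refl ; (there g∈) → there (es′⊆ g∈) }
  ...   | yes e∈ with split t e∈
  ...     | forward  es₁ es₂ refl _ t₂ =
              e ∷ es₂ , fwd e refl t₂ , Unique-++⁻ʳ es₁ t! , there ∘ es′⊆ ∘ ∈-++⁺ʳ es₁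
  ...     | backward es₁ es₂ refl _ t₂ with Unique-++⁻ʳ es₁ t!
  ...       | _ ∷ es₂! = es₂ , t₂ , es₂! , there ∘ es′⊆ ∘ ∈-++⁺ʳ es₁ ∘ there
  toTrail (bwd e refl r) with toTrail r
  ... | es′ , t , t! , es′⊆ with ∈?[ _≟_ ] e es′
  ...   | no e∉ = e ∷ es′ , bwd e refl t , ¬Any⇒All¬ es′ e∉ ∷ t! ,
                  λ { (here refl) → here refl ; (there g∈) → there (es′⊆ g∈) }
  ...   | yes e∈ with split t e∈
  ...     | backward es₁ es₂ refl _ t₂ =
              e ∷ es₂ , bwd e refl t₂ , Unique-++⁻ʳ es₁ t! , there ∘ es′⊆ ∘ ∈-++⁺ʳ es₁
  ...     | forward  es₁ es₂ refl _ t₂ with Unique-++⁻ʳ es₁ t!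
  ...       | _ ∷ es₂! = es₂ , t₂ , es₂! , there ∘ es′⊆ ∘ ∈-++⁺ʳ es₁ ∘ there

  data AvoidingWalk (f : Fin m) : Fin n → Fin n → Set where
    nil : ∀ {u} → AvoidingWalk f u u
    fwd : ∀ {v} e → e ≢ f → AvoidingWalk f (tgt e) v → AvoidingWalk f (src e) v
    bwd : ∀ {v} e → e ≢ f → AvoidingWalk f (src e) v → AvoidingWalk f (tgt e) v

  toAvoiding : ∀ {f u v es} → Walk H u v es → f ∉ es → AvoidingWalk f u v
  toAvoiding nil            _   = nil
  toAvoiding (fwd e refl r) f∉ = fwd e (λ { refl → f∉ (here refl) }) (toAvoiding r (f∉ ∘ there))
  toAvoiding (bwd e refl r) f∉ = bwd e (λ { refl → f∉ (here refl) }) (toAvoiding r (f∉ ∘ there))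

  fromAvoiding : ∀ {f u v} → AvoidingWalk f u v → ∃[ es ] (Walk H u v es × f ∉ es)
  fromAvoiding nil = [] , nil , λ ()
  fromAvoiding (fwd e e≢f a) with fromAvoiding a
  ... | es , r , f∉ = e ∷ es , fwd e refl r , λ { (here refl) → e≢f refl ; (there f∈) → f∉ f∈ }
  fromAvoiding (bwd e e≢f a) with fromAvoiding a
  ... | es , r , f∉ = e ∷ es , bwd e refl r , λ { (here refl) → e≢f refl ; (there f∈) → f∉ f∈ }

  _++ᵃ_ : ∀ {f u v z} → AvoidingWalk f u v → AvoidingWalk f v z → AvoidingWalk f u z
  nil           ++ᵃ b = b
  fwd e e≢f a   ++ᵃ b = fwd e e≢f (a ++ᵃ b)
  bwd e e≢f a   ++ᵃ b = bwd e e≢f (a ++ᵃ b)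

  reverseᵃ : ∀ {f u v} → AvoidingWalk f u v → AvoidingWalk f v u
  reverseᵃ nil           = nil
  reverseᵃ (fwd e e≢f a) = reverseᵃ a ++ᵃ bwd e e≢f nil
  reverseᵃ (bwd e e≢f a) = reverseᵃ a ++ᵃ fwd e e≢f nil

module TreeSides {n k : ℕ} (T : Graph n k) (tree : IsTree T) where
  open Graph T
  open Walks T

  private
    connected = proj₁ tree
    acyclic   = proj₂ tree

  -- Acyclicity only speaks about closed trails, so the detour is first shortened to a trail.
  no-detour : ∀ f → ¬ AvoidingWalk f (tgt f) (src f)
  no-detour f a with fromAvoiding a
  ... | es , r , f∉es with toTrail r
  ... | es′ , t , t! , es′⊆es
      with acyclic (src f) (f ∷ es′) (fwd f refl t) (¬Any⇒All¬ es′ (f∉es ∘ es′⊆es) ∷ t!)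
  ... | ()

  trailFrom : ∀ f z → ∃[ es ] (Walk T (src f) z es × Unique es × es ⊆ proj₁ (connected (src f) z))
  trailFrom f z = toTrail (proj₂ (connected (src f) z))

  -- A trail from src f to z avoids f exactly when z lies on src f's side of f, whichever
  -- trail is chosen.
  side : Fin k → VSet T
  side f z = not (does (∈?[ _≟_ ] f (proj₁ (trailFrom f z))))

  side⇒avoiding : ∀ f z → side f z ≡ true → AvoidingWalk f (src f) z
  side⇒avoiding f z _ with trailFrom f z
  ... | es , t , _ , _ with ∈?[ _≟_ ] f es
  ...   | no f∉ = toAvoiding t f∉

  avoiding⇒side : ∀ f z → AvoidingWalk f (src f) z → side f z ≡ true
  avoiding⇒side f z a with trailFrom f z
  ... | es , t , t! , _ with ∈?[ _≟_ ] f es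
  ...   | no _ = refl
  ...   | yes f∈ with split t f∈
  ...     | forward  es₁ es₂ refl _  t₂ =
              ⊥-elim (no-detour f (toAvoiding t₂ (∉-suffix es₁ t!) ++ᵃ reverseᵃ a))
  ...     | backward es₁ es₂ refl t₁ _ =
              ⊥-elim (no-detour f (reverseᵃ (toAvoiding t₁ (∉-prefix es₁ t!))))

  side-isSide : ∀ f → IsSideOf T f (side f)
  side-isSide f z = (λ z∈ → fromAvoiding (side⇒avoiding f z z∈)) ,
                    (λ es r f∉ → avoiding⇒side f z (toAvoiding r f∉))

  side-src : ∀ f → side f (src f) ≡ true
  side-src f = avoiding⇒side f (src f) nil

  side-tgt : ∀ f → side f (tgt f) ≡ false
  side-tgt f with side f (tgt f) in tgt∈
  ... | true  = ⊥-elim (no-detour f (reverseᵃ (side⇒avoiding f (tgt f) tgt∈)))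
  ... | false = refl

  side-across : ∀ f {g} → g ≢ f → side f (src g) ≡ side f (tgt g)
  side-across f {g} g≢f = ≡true⇔⇒≡
    (λ src∈ → avoiding⇒side f (tgt g) (side⇒avoiding f (src g) src∈ ++ᵃ fwd g g≢f nil))
    (λ tgt∈ → avoiding⇒side f (src g) (side⇒avoiding f (tgt g) tgt∈ ++ᵃ bwd g g≢f nil))

  cocycle-side-self : ∀ f → cocycleOf T (side f) f ≡ true
  cocycle-side-self f = cong₂ _xor_ (side-src f) (side-tgt f)

  cocycle-side-other : ∀ f {g} → g ≢ f → cocycleOf T (side f) g ≡ false
  cocycle-side-other f {g} g≢f = trans (cong (_xor side f (tgt g)) (side-across f g≢f)) (xor-same (side f (tgt g)))

  cocycle-lincomb-side : ∀ S g → cocycleOf T (lincomb S side) g ≡ S g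
  cocycle-lincomb-side S g = begin
    cocycleOf T (lincomb S side) g                   ≡⟨ cocycleOf-lincomb S side g ⟩
    parity (λ f → S f ∧ cocycleOf T (side f) g)      ≡⟨ parity-single _ g off-g ⟩
    S g ∧ cocycleOf T (side g) g                     ≡⟨ cong (S g ∧_) (cocycle-side-self g) ⟩
    S g ∧ true                                       ≡⟨ ∧-identityʳ (S g) ⟩
    S g                                              ∎
    where
    open ≡-Reasoning
    off-g : ∀ f → f ≢ g → S f ∧ cocycleOf T (side f) g ≡ false
    off-g f f≢g = trans (cong (S f ∧_) (cocycle-side-other f (≢-sym f≢g))) (∧-zeroʳ (S f))

  lincomb-side-separation : ∀ (X : VSet T) x y →
    lincomb (cocycleOf T X) side x xor lincomb (cocycleOf T X) side y ≡ X x xor X y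
  lincomb-side-separation X =
    sameCocycle⇒sameSeparation connected (lincomb (cocycleOf T X) side) X (cocycle-lincomb-side (cocycleOf T X))

  separatingEdge : ∀ {x y} → x ≢ y → ∃[ f ] side f x ≢ side f y
  separatingEdge {x} {y} x≢y = lincomb-separates (cocycleOf T (singleton x)) side
    (xor≡true⇒≢ (trans (lincomb-side-separation (singleton x) x y)
                       (≢⇒xor≡true (singleton-separates x≢y))))

module Weights {c ℓ₁ ℓ₂} (D : WeightDomain c ℓ₁ ℓ₂) where
  open WeightDomain D
  open IsCommutativeMonoid isCommutativeMonoid
    using (comm; identityˡ; identityʳ; ∙-cong)
    renaming (refl to ≈-refl; sym to ≈-sym; trans to ≈-trans)
  open IsTotalOrder isTotalOrder using () renaming (refl to ≤-refl; trans to ≤-trans; reflexive to ≤-reflexive)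

  totalOrder : TotalOrder c ℓ₁ ℓ₂
  totalOrder = record { isTotalOrder = isTotalOrder }

  open PartialOrderReasoning (TotalOrder.poset totalOrder)
  open Extrema totalOrder using (argmax; argmin; f[xs]≤f[argmax]; f[argmin]≤f[xs])

  +-monoʳ-≤ : ∀ x {y z} → y ≤ z → x + y ≤ x + z
  +-monoʳ-≤ x {y} {z} y≤z = begin
    x + y ≈⟨ comm x y ⟩
    y + x ≤⟨ +-monoˡ-≤ x y≤z ⟩
    z + x ≈⟨ comm z x ⟩
    x + z ∎

  x≤x+y : ∀ x {y} → 0# ≤ y → x ≤ x + y
  x≤x+y x {y} 0≤y = begin
    x      ≈⟨ identityʳ x ⟨
    x + 0# ≤⟨ +-monoʳ-≤ x 0≤y ⟩
    x + y  ∎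

  y≤x+y : ∀ {x} y → 0# ≤ x → y ≤ x + y
  y≤x+y {x} y 0≤x = begin
    y      ≈⟨ identityˡ y ⟨
    0# + y ≤⟨ +-monoˡ-≤ y 0≤x ⟩
    x + y  ∎

  ∑-cong : ∀ k {f g : Fin k → Carrier} → (∀ i → f i ≡ g i) → ∑ D k f ≡ ∑ D k g
  ∑-cong zero    _   = refl
  ∑-cong (suc k) f≗g = cong₂ _+_ (f≗g zero) (∑-cong k (f≗g ∘ suc))

  ∑-nonneg : ∀ k {f : Fin k → Carrier} → (∀ i → 0# ≤ f i) → 0# ≤ ∑ D k f
  ∑-nonneg zero    _   = ≤-refl
  ∑-nonneg (suc k) f≥0 = ≤-trans (f≥0 zero) (x≤x+y _ (∑-nonneg k (f≥0 ∘ suc)))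

  term≤∑ : ∀ k {f : Fin k → Carrier} → (∀ i → 0# ≤ f i) → ∀ j → f j ≤ ∑ D k f
  term≤∑ (suc k) f≥0 zero    = x≤x+y _ (∑-nonneg k (f≥0 ∘ suc))
  term≤∑ (suc k) f≥0 (suc j) = ≤-trans (term≤∑ k (f≥0 ∘ suc) j) (y≤x+y _ (f≥0 zero))

  ∑-zero : ∀ k {f : Fin k → Carrier} → (∀ i → f i ≈ 0#) → ∑ D k f ≈ 0#
  ∑-zero zero    _   = ≈-refl
  ∑-zero (suc k) f≈0 = ≈-trans (∙-cong (f≈0 zero) (∑-zero k (f≈0 ∘ suc))) (identityˡ 0#)

  ∑-single : ∀ k {f : Fin k → Carrier} j → (∀ i → i ≢ j → f i ≈ 0#) → ∑ D k f ≈ f j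
  ∑-single (suc k) zero others =
    ≈-trans (∙-cong ≈-refl (∑-zero k (λ i → others (suc i) (λ ())))) (identityʳ _)
  ∑-single (suc k) (suc j) others =
    ≈-trans (∙-cong (others zero (λ ())) (∑-single k j (λ i i≢j → others (suc i) (i≢j ∘ suc-injective))))
            (identityˡ _)

  maximiser : ∀ {k} → Fin k → (Fin k → Carrier) → Fin k
  maximiser i₀ f = argmax f i₀ (allFin _)

  ≤-maximiser : ∀ {k} i₀ (f : Fin k → Carrier) i → f i ≤ f (maximiser i₀ f)
  ≤-maximiser i₀ f i = lookup (f[xs]≤f[argmax] {f = f} i₀ (allFin _)) (∈-allFin i)

  minimiser : ∀ {k} → Fin k → (Fin k → Carrier) → Fin k
  minimiser i₀ f = argmin f i₀ (allFin _)

  minimiser-≤ : ∀ {k} i₀ (f : Fin k → Carrier) i → f (minimiser i₀ f) ≤ f i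
  minimiser-≤ i₀ f i = lookup (f[argmin]≤f[xs] {f = f} i₀ (allFin _)) (∈-allFin i)

  module _ {n m : ℕ} (G : Graph n m) (w : Fin m → Carrier) where
    open Graph G

    weight-cong : ∀ {C C′ : ESet G} → (∀ e → C e ≡ C′ e) → weight D G w C ≡ weight D G w C′
    weight-cong C≗C′ = ∑-cong m (λ e → cong (λ b → if b then w e else 0#) (C≗C′ e))

    w≤weight : Nonneg D G w → ∀ {C : ESet G} {f} → C f ≡ true → w f ≤ weight D G w C
    w≤weight w≥0 {C} {f} f∈C =
      subst (λ b → (if b then w f else 0#) ≤ weight D G w C) f∈C (term≤∑ m (λ e → term≥0 (C e) e) f)
      where
      term≥0 : ∀ b e → 0# ≤ (if b then w e else 0#)
      term≥0 true  e = w≥0 e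
      term≥0 false e = ≤-refl

    IsLocalCon-resp-≈ : ∀ {x y u u′} → u ≈ u′ → IsLocalCon D G w x y u → IsLocalCon D G w x y u′
    IsLocalCon-resp-≈ u≈u′ ((X , sep , cut≈u) , minimal) =
      (X , sep , ≈-trans cut≈u u≈u′) , λ X′ sep′ → ≤-trans (≤-reflexive (≈-sym u≈u′)) (minimal X′ sep′)

    localCon≤cut : ∀ {x y u} → IsLocalCon D G w x y u → ∀ (Y : VSet G) → Y x ≢ Y y →
                   u ≤ weight D G w (cocycleOf G Y)
    localCon≤cut {x} {y} {u} (_ , minimal) Y Yx≢Yy with Y x in Yx | Y y in Yy
    ... | true  | false = minimal Y (Yx , Yy)
    ... | false | true  =
      subst (u ≤_) (weight-cong (λ e → xor-annihilates-not (Y (src e)) (Y (tgt e))))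
            (minimal (not ∘ Y) (cong not Yx , cong not Yy))
    ... | true  | true  = ⊥-elim (Yx≢Yy refl)
    ... | false | false = ⊥-elim (Yx≢Yy refl)

    weight-singleton : ∀ x → weight D G w (cocycleOf G (singleton x)) ≡ deg D G w x
    weight-singleton x = ∑-cong m term
      where
      term : ∀ e → (if cocycleOf G (singleton x) e then w e else 0#) ≡
                   (if does (src e ≟ x) then w e else (if does (tgt e ≟ x) then w e else 0#))
      term e with src e ≟ x | tgt e ≟ x
      ... | yes s≡x | yes t≡x = ⊥-elim (loopless e (trans s≡x (sym t≡x)))
      ... | yes _   | no _    = refl
      ... | no _    | yes _   = refl
      ... | no _    | no _    = refl

    localCon≤deg : ∀ {x y u} → IsLocalCon D G w x y u → ∀ z → singleton z x ≢ singleton z y →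
                   u ≤ deg D G w z
    localCon≤deg {u = u} λxy z separates =
      subst (u ≤_) (weight-singleton z) (localCon≤cut λxy (singleton z) separates)

    localCon≤Δ₂ : ∀ {x y u d₂} → x ≢ y → IsLocalCon D G w x y u → IsΔ₂ D G w d₂ → u ≤ d₂
    localCon≤Δ₂ {x} {y} x≢y λxy ((x₁ , _ , below) , _) with x ≟ x₁
    ... | no  x≢x₁ = ≤-trans (localCon≤deg λxy x (singleton-separates x≢y)) (below x x≢x₁)
    ... | yes refl =
      ≤-trans (localCon≤deg λxy y (≢-sym (singleton-separates (≢-sym x≢y)))) (below y (≢-sym x≢y))

    Δ₂≤Δ : ∀ {d₂ d} → IsΔ₂ D G w d₂ → IsΔ D G w d → d₂ ≤ d
    Δ₂≤Δ {d₂} {d} ((_ , (x , _ , degx≈d₂) , _) , _) (_ , ≤d) = begin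
      d₂          ≈⟨ degx≈d₂ ⟨
      deg D G w x ≤⟨ ≤d x ⟩
      d           ∎

    Δ-exists : Fin n → ∃[ d ] IsΔ D G w d
    Δ-exists x₀ = deg D G w x , (x , ≈-refl) , ≤-maximiser x₀ (deg D G w)
      where x = maximiser x₀ (deg D G w)

  Δ₂-exists : ∀ {n′ m} (G : Graph (suc (suc n′)) m) (w : Fin m → Carrier) → ∃[ d₂ ] IsΔ₂ D G w d₂
  Δ₂-exists G w = maxWithout x₁ , (x₁ , maxWithout-isMax x₁) , minimal
    where
    degree = deg D G w
    maxWithout : Fin _ → Carrier
    maxWithout x₁ = degree (punchIn x₁ (maximiser zero (degree ∘ punchIn x₁)))
    maxWithout-isMax : ∀ x₁ → IsMaxDegWithout D G w x₁ (maxWithout x₁)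
    maxWithout-isMax x₁ =
      (_ , punchInᵢ≢i x₁ _ , ≈-refl) ,
      λ x x≢x₁ → subst (λ z → degree z ≤ maxWithout x₁) (punchIn-punchOut (≢-sym x≢x₁))
                       (≤-maximiser zero (degree ∘ punchIn x₁) (punchOut (≢-sym x≢x₁)))
    x₁ = minimiser zero maxWithout
    minimal : ∀ x₁′ u → IsMaxDegWithout D G w x₁′ u → maxWithout x₁ ≤ u
    minimal x₁′ u (_ , below) = ≤-trans (minimiser-≤ zero maxWithout x₁′) (below _ (punchInᵢ≢i x₁′ _))

module TreeCuts {c ℓ₁ ℓ₂} (D : WeightDomain c ℓ₁ ℓ₂) {n k : ℕ} (T : Graph n k) (tree : IsTree T)
                (wT : Fin k → WeightDomain.Carrier D) (wT≥0 : Nonneg D T wT) where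
  open WeightDomain D
  open IsCommutativeMonoid isCommutativeMonoid using () renaming (reflexive to ≈-reflexive; trans to ≈-trans)
  open Weights D
  open Graph T
  open TreeSides T tree

  weight-side : ∀ f → weight D T wT (cocycleOf T (side f)) ≈ wT f
  weight-side f =
    ≈-trans (∑-single k f (λ g g≢f → ≈-reflexive (cong (λ b → if b then wT g else 0#) (cocycle-side-other f g≢f))))
            (≈-reflexive (cong (λ b → if b then wT f else 0#) (cocycle-side-self f)))

  localCon-treeEdge : ∀ f → IsLocalCon D T wT (src f) (tgt f) (wT f)
  localCon-treeEdge f =
    (side f , (side-src f , side-tgt f) , weight-side f) ,
    λ X (Xsrc , Xtgt) → w≤weight T wT wT≥0 (cong₂ _xor_ Xsrc Xtgt)

module CocycleBases {c ℓ₁ ℓ₂} (D : WeightDomain c ℓ₁ ℓ₂) {n m : ℕ} (G : Graph n m)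
                    (w : Fin m → WeightDomain.Carrier D) (connected : Connected G) where
  open WeightDomain D
  open Weights D
  open Walks G using (sameCocycle⇒sameSeparation; cocycleOf-lincomb)

  combo≡lincomb : ∀ {k} (B : Fin k → ESet G) S e → combo D G w B S e ≡ lincomb S B e
  combo≡lincomb {zero}  B S e = refl
  combo≡lincomb {suc k} B S e = cong₂ _xor_ (if≡∧ (S zero)) (combo≡lincomb (B ∘ suc) (S ∘ suc) e)
    where
    if≡∧ : ∀ b → (if b then B zero e else false) ≡ b ∧ B zero e
    if≡∧ true  = refl
    if≡∧ false = refl

  combo-cocycles : ∀ {k} {B : Fin k → ESet G} {Y : Fin k → VSet G} → (∀ i e → B i e ≡ cocycleOf G (Y i) e) →
                   ∀ S e → combo D G w B S e ≡ cocycleOf G (lincomb S Y) e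
  combo-cocycles {B = B} {Y} B≗ S e = begin
    combo D G w B S e                     ≡⟨ combo≡lincomb B S e ⟩
    lincomb S B e                         ≡⟨ parity-cong (λ i → cong (S i ∧_) (B≗ i e)) ⟩
    lincomb S (λ i → cocycleOf G (Y i)) e ≡⟨ cocycleOf-lincomb S Y e ⟨
    cocycleOf G (lincomb S Y) e           ∎
    where open ≡-Reasoning

  localCon≤maxBasisWeight : ∀ {k} {B : Fin k → ESet G} {u} → IsCocycleBasis D G w B → IsMaxWeightIn D G w B u →
                            ∀ {x y v} → x ≢ y → IsLocalCon D G w x y v → v ≤ u
  localCon≤maxBasisWeight {k} {B} {u} (cocycles , _ , spans) (_ , ≤u) {x} {y} {v} x≢y λxy = begin
    v                               ≤⟨ localCon≤cut G w λxy (Y i) separates ⟩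
    weight D G w (cocycleOf G (Y i)) ≡⟨ weight-cong G w (B≗ i) ⟨
    weight D G w (B i)               ≤⟨ ≤u i ⟩
    u                                ∎
    where
    open PartialOrderReasoning (TotalOrder.poset totalOrder)
    Y : Fin k → VSet G
    Y i = proj₁ (cocycles i)
    B≗ : ∀ i e → B i e ≡ cocycleOf G (Y i) e
    B≗ i = proj₂ (cocycles i)
    S : Fin k → Bool
    S = proj₁ (spans (cocycleOf G (singleton x)) (singleton x , λ _ → refl))
    singleton≗ : ∀ e → cocycleOf G (singleton x) e ≡ cocycleOf G (lincomb S Y) e
    singleton≗ e = trans (proj₂ (spans _ _) e) (combo-cocycles {Y = Y} B≗ S e)
    lincomb-separates-xy : lincomb S Y x ≢ lincomb S Y y
    lincomb-separates-xy = xor≡true⇒≢ (trans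
      (sym (sameCocycle⇒sameSeparation connected (singleton x) (lincomb S Y) singleton≗ x y))
      (≢⇒xor≡true (singleton-separates x≢y)))
    i         = proj₁ (lincomb-separates S Y lincomb-separates-xy)
    separates = proj₂ (lincomb-separates S Y lincomb-separates-xy)

  module _ {k} (T : Graph n k) (tree : IsTree T) where
    open TreeSides T tree

    fundamentalCuts-basis : IsCocycleBasis D G w (λ f → cocycleOf G (side f))
    fundamentalCuts-basis = (λ f → side f , λ _ → refl) , independent , spanning
      where
      open ≡-Reasoning
      independent : ∀ S → (∀ e → combo D G w (λ f → cocycleOf G (side f)) S e ≡ false) → ∀ f → S f ≡ false
      independent S combo≡false f = begin
        S f                            ≡⟨ cocycle-lincomb-side S f ⟨
        cocycleOf T (lincomb S side) f ≡⟨ sameCocycle⇒sameSeparation connected (lincomb S side) (λ _ → false)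
                                            cocycle≡∅ (Graph.src T f) (Graph.tgt T f) ⟩
        false                          ∎
        where
        cocycle≡∅ : ∀ e → cocycleOf G (lincomb S side) e ≡ false
        cocycle≡∅ e = trans (sym (combo-cocycles {Y = side} (λ _ _ → refl) S e)) (combo≡false e)
      spanning : ∀ C → IsCocycle G C → ∃[ S ] (∀ e → C e ≡ combo D G w (λ f → cocycleOf G (side f)) S e)
      spanning C (X , C≗) = cocycleOf T X , λ e → begin
        C e                                          ≡⟨ C≗ e ⟩
        cocycleOf G X e                              ≡⟨ lincomb-side-separation X (Graph.src G e) (Graph.tgt G e) ⟨
        cocycleOf G (lincomb (cocycleOf T X) side) e ≡⟨ combo-cocycles {Y = side} (λ _ _ → refl) (cocycleOf T X) e ⟨
        combo D G w (λ f → cocycleOf G (side f)) (cocycleOf T X) e ∎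

module GomoryHu {c ℓ₁ ℓ₂} (D : WeightDomain c ℓ₁ ℓ₂) {n m k : ℕ}
                (G : Graph n m) (w : Fin m → WeightDomain.Carrier D) (connected : Connected G)
                (T : Graph n k) (wT : Fin k → WeightDomain.Carrier D) (gomoryHu : IsGomoryHuTree D G w T wT)
                {x₀ y₀ : Fin n} (x₀≢y₀ : x₀ ≢ y₀) where
  open WeightDomain D
  open IsTotalOrder isTotalOrder using () renaming (trans to ≤-trans; reflexive to ≤-reflexive)
  open IsCommutativeMonoid isCommutativeMonoid using () renaming (refl to ≈-refl)
  open Weights D
  open CocycleBases D G w connected
  open Graph T

  private
    tree        = proj₁ gomoryHu
    wT≥0        = proj₁ (proj₂ gomoryHu)
    sameFlow    = proj₁ (proj₂ (proj₂ gomoryHu))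
    sidesAreMin = proj₂ (proj₂ (proj₂ gomoryHu))

  open TreeSides T tree
  open TreeCuts D T tree wT wT≥0

  fundamentalCut : Fin k → ESet G
  fundamentalCut f = cocycleOf G (side f)

  localCon-fundamental : ∀ f → IsLocalCon D G w (src f) (tgt f) (weight D G w (fundamentalCut f))
  localCon-fundamental f = sidesAreMin f (side f) (side-isSide f)

  weight-fundamental : ∀ f → weight D G w (fundamentalCut f) ≈ wT f
  weight-fundamental f = sameFlow (src f) (tgt f) (loopless f) _ _ (localCon-fundamental f) (localCon-treeEdge f)

  heaviest : Fin k
  heaviest = maximiser (proj₁ (separatingEdge x₀≢y₀)) wT

  ≤-heaviest : ∀ f → wT f ≤ wT heaviest
  ≤-heaviest = ≤-maximiser _ wT

  localCon-heaviest : IsLocalCon D G w (src heaviest) (tgt heaviest) (wT heaviest)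
  localCon-heaviest = IsLocalCon-resp-≈ G w (weight-fundamental heaviest) (localCon-fundamental heaviest)

  isΛ̂ : IsΛ̂ D T wT (wT heaviest)
  isΛ̂ = (heaviest , ≈-refl) , ≤-heaviest

  isΛ : IsΛ D G w (wT heaviest)
  isΛ = (src heaviest , tgt heaviest , loopless heaviest , localCon-heaviest) , bounded
    where
    open PartialOrderReasoning (TotalOrder.poset totalOrder)
    bounded : ∀ x y u → x ≢ y → IsLocalCon D G w x y u → u ≤ wT heaviest
    bounded x y u x≢y λxy = begin
      u                                  ≤⟨ localCon≤cut G w λxy (side f) separates ⟩
      weight D G w (fundamentalCut f)    ≈⟨ weight-fundamental f ⟩
      wT f                               ≤⟨ ≤-heaviest f ⟩
      wT heaviest                        ∎
      where
      f         = proj₁ (separatingEdge x≢y)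
      separates = proj₂ (separatingEdge x≢y)

  isΛ̃ : IsΛ̃ D G w (wT heaviest)
  isΛ̃ = (k , fundamentalCut , fundamentalCuts-basis T tree , (heaviest , weight-fundamental heaviest) ,
         λ f → ≤-trans (≤-reflexive (weight-fundamental f)) (≤-heaviest f)) ,
        λ _ _ _ basis maximal → localCon≤maxBasisWeight basis maximal (loopless heaviest) localCon-heaviest

theorem2p8 : ∀ {c ℓ₁ ℓ₂ : Level} (D : WeightDomain c ℓ₁ ℓ₂) →
    let open WeightDomain D in
    ∀ {n m k : ℕ} → 2 ≤ℕ n →
    (G : Graph n m) (w : Fin m → Carrier) →
    Connected G → Nonneg D G w →
    (T : Graph n k) (wT : Fin k → Carrier) →
    IsGomoryHuTree D G w T wT →
    Σ[ v ∈ Carrier ] (IsΛ D G w v × IsΛ̂ D T wT v × IsΛ̃ D G w v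
      × Σ[ d₂ ∈ Carrier ] (IsΔ₂ D G w d₂ × v ≤ d₂
        × Σ[ d ∈ Carrier ] (IsΔ D G w d × d₂ ≤ d)))
theorem2p8 D {suc (suc n′)} (s≤s (s≤s z≤n)) G w connected _ T wT gomoryHu =
  wT heaviest , isΛ , isΛ̂ , isΛ̃ ,
  d₂ , isΔ₂ , localCon≤Δ₂ G w (Graph.loopless T heaviest) localCon-heaviest isΔ₂ ,
  d , isΔ , Δ₂≤Δ G w isΔ₂ isΔ
  where
  open Weights D
  open GomoryHu D G w connected T wT gomoryHu {zero} {suc zero} (λ ())
  d₂   = proj₁ (Δ₂-exists G w)
  isΔ₂ = proj₂ (Δ₂-exists G w)
  d    = proj₁ (Δ-exists G w zero)
  isΔ  = proj₂ (Δ-exists G w zero)
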